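{- Let $\Pi$ be a projective plane of order $p^2$, $p\geq 3$ prime, let $c\in\mathrm{C}(\Pi)^\perp$ have weight $2p^2-2p+2+\epsilon$ with $1\leq\epsilon\leq p-2$, and let $\mathcal{S}$ be the support of $c$. For every $P\in\mathcal{S}$, the number $x_P$ of lines through $P$ meeting $\mathcal{S}$ in exactly $2$ points satisfies $x_P\geq 2p+1-\epsilon$.
   Context: $\mathrm{C}(\Pi)$ is the $\mathbb{F}_p$-span of the incidence vectors of the lines of $\Pi$, viewed as vectors indexed by points; $\mathrm{C}(\Pi)^\perp$ is the set of vectors $v$ with $\sum_{P\in\ell}v_P=0$ in $\mathbb{F}_p$ for every line $\ell$. The support is the set of points where $c$ is non-zero, and the weight is its size. -}

module Defs where

open import Data.Nat using (ℕ; zero; suc; _+_; _≡ᵇ_)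
open import Data.Fin using (Fin; zero; suc; toℕ)
open import Data.Nat.Divisibility using (_∣_)
open import Data.Bool using (Bool; true; false; if_then_else_; _∧_; not)
open import Data.Product using (Σ; _×_; _,_)
open import Relation.Binary.PropositionalEquality using (_≡_; _≢_)
open import Relation.Nullary using (¬_)

sumFin : (n : ℕ) → (Fin n → ℕ) → ℕ
sumFin zero    f = 0
sumFin (suc n) f = f zero + sumFin n (λ i → f (suc i))

count : (n : ℕ) → (Fin n → Bool) → ℕ
count n b = sumFin n (λ i → if b i then 1 else 0)

record ProjectivePlane (q : ℕ) : Set where
  field
    nP nL : ℕ
    I : Fin nP → Fin nL → Bool
    two-points : (P Q : Fin nP) → P ≢ Q →
      Σ (Fin nL) λ ℓ → (I P ℓ ≡ true) × (I Q ℓ ≡ true) ×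
        ((m : Fin nL) → I P m ≡ true → I Q m ≡ true → m ≡ ℓ)
    two-lines : (ℓ m : Fin nL) → ℓ ≢ m →
      Σ (Fin nP) λ P → (I P ℓ ≡ true) × (I P m ≡ true) ×
        ((Q : Fin nP) → I Q ℓ ≡ true → I Q m ≡ true → Q ≡ P)
    quadrangle : Σ (Fin nP) λ A → Σ (Fin nP) λ B → Σ (Fin nP) λ C → Σ (Fin nP) λ D →
      (A ≢ B) × (A ≢ C) × (A ≢ D) × (B ≢ C) × (B ≢ D) × (C ≢ D) ×
      ((ℓ : Fin nL) → ¬ ((I A ℓ ≡ true) × (I B ℓ ≡ true) × (I C ℓ ≡ true))) ×
      ((ℓ : Fin nL) → ¬ ((I A ℓ ≡ true) × (I B ℓ ≡ true) × (I D ℓ ≡ true))) ×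
      ((ℓ : Fin nL) → ¬ ((I A ℓ ≡ true) × (I C ℓ ≡ true) × (I D ℓ ≡ true))) ×
      ((ℓ : Fin nL) → ¬ ((I B ℓ ≡ true) × (I C ℓ ≡ true) × (I D ℓ ≡ true)))
    order : (ℓ : Fin nL) → count nP (λ P → I P ℓ) ≡ suc q

module _ {q : ℕ} (Π : ProjectivePlane q) (p : ℕ) where
  open ProjectivePlane Π

  -- Vectors over F_p indexed by points; F_p is represented by Fin p with
  -- arithmetic mod p.
  Word : Set
  Word = Fin nP → Fin p

  isZero : Fin p → Bool
  isZero zero    = true
  isZero (suc _) = false

  inSupp : Word → Fin nP → Bool
  inSupp c P = not (isZero (c P))

  weight : Word → ℕ
  weight c = count nP (inSupp c)

  -- c ∈ C(Π)^⊥ : for every line ℓ, ∑_{P ∈ ℓ} c_P = 0 in F_p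
  inDualCode : Word → Set
  inDualCode c = (ℓ : Fin nL) →
    p ∣ sumFin nP (λ P → if I P ℓ then toℕ (c P) else 0)

  meetSupp : Word → Fin nL → ℕ
  meetSupp c ℓ = count nP (λ Q → I Q ℓ ∧ inSupp c Q)

  xP : Word → Fin nP → ℕ
  xP c P = count nL (λ ℓ → I P ℓ ∧ (meetSupp c ℓ ≡ᵇ 2))

{-# OPTIONS --safe #-}
-- Fix P in the support S of c. The lines through P partition the points other
-- than P, so summing |ℓ ∩ S| − 1 over the q + 1 lines ℓ through P gives
-- |S| − 1. Since the coordinates of c on a line sum to 0 in F_p and c_P ≠ 0,
-- no line through P meets S in P alone: every summand is at least 1, and at
-- least 2 unless ℓ is one of the x_P lines with |ℓ ∩ S| = 2. Hence
-- 2(q + 1) − x_P ≤ |S| − 1, which for q = p² and |S| = 2p² − 2p + 2 + ε is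
-- the claimed bound.
module Submission where

open import Defs
open import Algebra.Properties.CommutativeSemigroup using (interchange; x∙yz≈y∙xz)
open import Data.Bool using (Bool; true; false; if_then_else_; _∧_; not)
open import Data.Bool.Properties using (∧-assoc; ∧-identityʳ; ∧-zeroʳ)
open import Data.Empty using (⊥-elim)
open import Data.Fin using (Fin; zero; suc; toℕ; _≟_)
open import Data.Fin.Properties using (toℕ<n)
open import Data.Nat using (ℕ; zero; suc; _+_; _*_; _∸_; _≤_; _<_; _≡ᵇ_; z≤n; s≤s; >-nonZero)
open import Data.Nat.Divisibility using (_∣_; >⇒∤)
open import Data.Nat.Primality using (Prime)
open import Data.Nat.Properties hiding (_≟_)
open import Data.Nat.Tactic.RingSolver using (solve-∀)
open import Data.Product using (Σ; _×_; _,_)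
open import Relation.Binary.PropositionalEquality
open import Relation.Nullary using (¬_; does; yes; no)
open import Relation.Nullary.Decidable using (dec-true; dec-false)

false≢true : false ≢ true
false≢true ()

∧-true⁻ : ∀ x {y} → x ∧ y ≡ true → x ≡ true × y ≡ true
∧-true⁻ true refl = refl , refl

𝟙 : Bool → ℕ
𝟙 b = if b then 1 else 0

sumFin-cong : ∀ n {f g : Fin n → ℕ} → (∀ i → f i ≡ g i) → sumFin n f ≡ sumFin n g
sumFin-cong zero    f≗g = refl
sumFin-cong (suc n) f≗g = cong₂ _+_ (f≗g zero) (sumFin-cong n (λ i → f≗g (suc i)))

sumFin-mono-≤ : ∀ n {f g : Fin n → ℕ} → (∀ i → f i ≤ g i) → sumFin n f ≤ sumFin n g
sumFin-mono-≤ zero    f≤g = z≤n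
sumFin-mono-≤ (suc n) f≤g = +-mono-≤ (f≤g zero) (sumFin-mono-≤ n (λ i → f≤g (suc i)))

sumFin-zero : ∀ n {f : Fin n → ℕ} → (∀ i → f i ≡ 0) → sumFin n f ≡ 0
sumFin-zero zero    f≗0 = refl
sumFin-zero (suc n) f≗0 = cong₂ _+_ (f≗0 zero) (sumFin-zero n (λ i → f≗0 (suc i)))

sumFin-distrib-+ : ∀ n (f g : Fin n → ℕ) →
  sumFin n (λ i → f i + g i) ≡ sumFin n f + sumFin n g
sumFin-distrib-+ zero    f g = refl
sumFin-distrib-+ (suc n) f g =
  trans (cong (f zero + g zero +_) (sumFin-distrib-+ n (f ∘suc) (g ∘suc)))
        (interchange +-commutativeSemigroup (f zero) (g zero) _ _)
  where
  _∘suc : (Fin (suc n) → ℕ) → Fin n → ℕ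
  (h ∘suc) i = h (suc i)

sumFin-comm : ∀ m n (f : Fin m → Fin n → ℕ) →
  sumFin m (λ i → sumFin n (f i)) ≡ sumFin n (λ j → sumFin m (λ i → f i j))
sumFin-comm zero    n f = sym (sumFin-zero n (λ _ → refl))
sumFin-comm (suc m) n f =
  trans (cong (sumFin n (f zero) +_) (sumFin-comm m n (λ i → f (suc i))))
        (sym (sumFin-distrib-+ n (f zero) _))

sumFin-remove : ∀ n (f : Fin n → ℕ) k →
  sumFin n f ≡ f k + sumFin n (λ j → if does (j ≟ k) then 0 else f j)
sumFin-remove (suc n) f zero    = refl
sumFin-remove (suc n) f (suc k) =
  trans (cong (f zero +_) (sumFin-remove n (λ j → f (suc j)) k))
        (x∙yz≈y∙xz +-commutativeSemigroup (f zero) (f (suc k)) _)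

sumFin-single : ∀ n (f : Fin n → ℕ) k → (∀ j → j ≢ k → f j ≡ 0) → sumFin n f ≡ f k
sumFin-single n f k vanish =
  trans (sumFin-remove n f k) (trans (cong (f k +_) (sumFin-zero n others)) (+-identityʳ (f k)))
  where
  others : ∀ j → (if does (j ≟ k) then 0 else f j) ≡ 0
  others j with j ≟ k
  ... | yes _   = refl
  ... | no j≢k = vanish j j≢k

erase : ∀ {n} → (Fin n → Bool) → Fin n → Fin n → Bool
erase b k j = b j ∧ not (does (j ≟ k))

count-remove : ∀ n (b : Fin n → Bool) k → b k ≡ true → count n b ≡ suc (count n (erase b k))
count-remove n b k bk = begin
  count n b
    ≡⟨ sumFin-remove n _ k ⟩
  𝟙 (b k) + sumFin n (λ j → if does (j ≟ k) then 0 else 𝟙 (b j))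
    ≡⟨ cong₂ _+_ (cong 𝟙 bk) (sumFin-cong n erased) ⟩
  suc (count n (erase b k)) ∎
  where
  open ≡-Reasoning
  erased : ∀ j → (if does (j ≟ k) then 0 else 𝟙 (b j)) ≡ 𝟙 (erase b k j)
  erased j with does (j ≟ k)
  ... | true  = cong 𝟙 (sym (∧-zeroʳ (b j)))
  ... | false = cong 𝟙 (sym (∧-identityʳ (b j)))

erase-self : ∀ {n} (b : Fin n → Bool) k → erase b k k ≡ false
erase-self b k = trans (cong (λ d → b k ∧ not d) (dec-true (k ≟ k) refl)) (∧-zeroʳ (b k))

count-unique : ∀ n (b : Fin n → Bool) k → b k ≡ true → (∀ j → b j ≡ true → j ≡ k) →
  count n b ≡ 1
count-unique n b k bk unique = trans (sumFin-single n _ k outside) (cong 𝟙 bk)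
  where
  outside : ∀ j → j ≢ k → 𝟙 (b j) ≡ 0
  outside j j≢k with b j in bj
  ... | true  = ⊥-elim (j≢k (unique j bj))
  ... | false = refl

count≡0⇒false : ∀ n (b : Fin n → Bool) → count n b ≡ 0 → ∀ j → b j ≡ false
count≡0⇒false (suc n) b count≡0 zero with b zero
... | false = refl
count≡0⇒false (suc n) b count≡0 (suc j) =
  count≡0⇒false n (λ i → b (suc i)) (m+n≡0⇒n≡0 (𝟙 (b zero)) count≡0) j

2≤m+𝟙[m≡1] : ∀ m → 1 ≤ m → 2 ≤ m + 𝟙 (m ≡ᵇ 1)
2≤m+𝟙[m≡1] (suc zero)    _ = s≤s (s≤s z≤n)
2≤m+𝟙[m≡1] (suc (suc m)) _ = s≤s (s≤s z≤n)

module _ {q : ℕ} (Π : ProjectivePlane q) where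
  open ProjectivePlane Π

  lines-through-two : ∀ P Q → P ≢ Q → count nL (λ ℓ → I P ℓ ∧ I Q ℓ) ≡ 1
  lines-through-two P Q P≢Q with two-points P Q P≢Q
  ... | ℓ , Pℓ , Qℓ , unique = count-unique nL _ ℓ (cong₂ _∧_ Pℓ Qℓ)
    λ m PQm → let Pm , Qm = ∧-true⁻ (I P m) PQm in unique m Pm Qm

  points-on-two : ∀ ℓ m → ℓ ≢ m → count nP (λ Q → I Q ℓ ∧ I Q m) ≡ 1
  points-on-two ℓ m ℓ≢m with two-lines ℓ m ℓ≢m
  ... | P , Pℓ , Pm , unique = count-unique nP _ P (cong₂ _∧_ Pℓ Pm)
    λ Q Qℓm → let Qℓ , Qm = ∧-true⁻ (I Q ℓ) Qℓm in unique Q Qℓ Qm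

  -- No point lies on all three sides of a triangle ABC: unless it is A, the
  -- two sides through A would both be the line joining it to A.
  avoiding-line : ∀ P → Σ (Fin nL) λ ℓ → I P ℓ ≡ false
  avoiding-line P with quadrangle
  ... | A , B , C , _ , A≢B , A≢C , _ , B≢C , _ , _ , ¬ABC , _
    with two-points A B A≢B | two-points A C A≢C | two-points B C B≢C
  ... | ab , Aab , Bab , _ | ac , Aac , Cac , _ | bc , Bbc , Cbc , _
    with I P ab in Pab | I P ac in Pac | I P bc in Pbc
  ... | false | _     | _     = ab , Pab
  ... | true  | false | _     = ac , Pac
  ... | true  | true  | false = bc , Pbc
  ... | true  | true  | true with P ≟ A
  ...   | yes refl = ⊥-elim (¬ABC bc (Pbc , Bbc , Cbc))
  ...   | no P≢A with two-points P A P≢A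
  ...     | _ , _ , _ , unique =
    ⊥-elim (¬ABC ac (Aac , subst (λ m → I B m ≡ true) ab≡ac Bab , Cac))
    where
    ab≡ac : ab ≡ ac
    ab≡ac = trans (unique ab Pab Aab) (sym (unique ac Pac Aac))

  pencil-partition : ∀ P (A : Fin nP → Bool) → A P ≡ false →
    sumFin nL (λ ℓ → if I P ℓ then count nP (λ Q → I Q ℓ ∧ A Q) else 0) ≡ count nP A
  pencil-partition P A AP = begin
    sumFin nL (λ ℓ → if I P ℓ then count nP (λ Q → I Q ℓ ∧ A Q) else 0)
      ≡⟨ sumFin-cong nL guard ⟩
    sumFin nL (λ ℓ → count nP (λ Q → I P ℓ ∧ (I Q ℓ ∧ A Q)))
      ≡⟨ sumFin-comm nL nP _ ⟩
    sumFin nP (λ Q → count nL (λ ℓ → I P ℓ ∧ (I Q ℓ ∧ A Q)))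
      ≡⟨ sumFin-cong nP row ⟩
    count nP A ∎
    where
    open ≡-Reasoning
    guard : ∀ ℓ → (if I P ℓ then count nP (λ Q → I Q ℓ ∧ A Q) else 0) ≡
                  count nP (λ Q → I P ℓ ∧ (I Q ℓ ∧ A Q))
    guard ℓ with I P ℓ
    ... | true  = refl
    ... | false = sym (sumFin-zero nP (λ _ → refl))
    row : ∀ Q → count nL (λ ℓ → I P ℓ ∧ (I Q ℓ ∧ A Q)) ≡ 𝟙 (A Q)
    row Q with A Q in AQ
    ... | false = sumFin-zero nL (λ ℓ →
      cong 𝟙 (trans (cong (I P ℓ ∧_) (∧-zeroʳ (I Q ℓ))) (∧-zeroʳ (I P ℓ))))
    ... | true  = trans
      (sumFin-cong nL (λ ℓ → cong (λ b → 𝟙 (I P ℓ ∧ b)) (∧-identityʳ (I Q ℓ))))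
      (lines-through-two P Q (λ { refl → false≢true (trans (sym AP) AQ) }))

  pencil-size : ∀ P → count nL (λ ℓ → I P ℓ) ≡ suc q
  pencil-size P with avoiding-line P
  ... | ℓ₀ , Pℓ₀ =
    trans (sumFin-cong nL meetsℓ₀) (trans (pencil-partition P (λ Q → I Q ℓ₀) Pℓ₀) (order ℓ₀))
    where
    meetsℓ₀ : ∀ ℓ → 𝟙 (I P ℓ) ≡ (if I P ℓ then count nP (λ Q → I Q ℓ ∧ I Q ℓ₀) else 0)
    meetsℓ₀ ℓ with I P ℓ in Pℓ
    ... | false = refl
    ... | true  = sym (points-on-two ℓ ℓ₀ (λ { refl → false≢true (trans (sym Pℓ₀) Pℓ) }))

  module _ (p : ℕ) {c : Word Π p} (c∈C⊥ : inDualCode Π p c)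
           {P : Fin nP} (P∈S : inSupp Π p c P ≡ true) where

    private
      S : Fin nP → Bool
      S = inSupp Π p c

    meetSupp-through : ∀ ℓ → I P ℓ ≡ true →
      meetSupp Π p c ℓ ≡ suc (count nP (λ Q → I Q ℓ ∧ erase S P Q))
    meetSupp-through ℓ Pℓ =
      trans (count-remove nP _ P (cong₂ _∧_ Pℓ P∈S))
            (cong suc (sumFin-cong nP (λ Q → cong 𝟙 (∧-assoc (I Q ℓ) (S Q) _))))

    -- If P were the only point of S on ℓ, the line sum of c would be c_P,
    -- a nonzero residue mod p.
    supp-meets-again : ∀ ℓ → I P ℓ ≡ true → 1 ≤ count nP (λ Q → I Q ℓ ∧ erase S P Q)
    supp-meets-again ℓ Pℓ with count nP (λ Q → I Q ℓ ∧ erase S P Q) in none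
    ... | suc _ = s≤s z≤n
    ... | zero  = ⊥-elim (∤toℕ (c P) P∈S (subst (p ∣_) lineSum≡cP (c∈C⊥ ℓ)))
      where
      open ≡-Reasoning
      ∤toℕ : ∀ x → not (isZero Π p x) ≡ true → ¬ p ∣ toℕ x
      ∤toℕ (suc j) _ = >⇒∤ (toℕ<n (suc j))
      vanish : ∀ b x → b ∧ not (isZero Π p x) ≡ false → (if b then toℕ x else 0) ≡ 0
      vanish false x       _ = refl
      vanish true  zero    _ = refl
      offP : ∀ Q → Q ≢ P → (if I Q ℓ then toℕ (c Q) else 0) ≡ 0
      offP Q Q≢P = vanish (I Q ℓ) (c Q) (begin
        I Q ℓ ∧ S Q          ≡⟨ cong (I Q ℓ ∧_) (∧-identityʳ (S Q)) ⟨
        I Q ℓ ∧ (S Q ∧ true) ≡⟨ cong (λ d → I Q ℓ ∧ (S Q ∧ not d)) (dec-false (Q ≟ P) Q≢P) ⟨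
        I Q ℓ ∧ erase S P Q  ≡⟨ count≡0⇒false nP _ none Q ⟩
        false                ∎)
      lineSum≡cP : sumFin nP (λ Q → if I Q ℓ then toℕ (c Q) else 0) ≡ toℕ (c P)
      lineSum≡cP =
        trans (sumFin-single nP _ P offP) (cong (λ b → if b then toℕ (c P) else 0) Pℓ)

    line-contribution : ∀ ℓ → 𝟙 (I P ℓ) + 𝟙 (I P ℓ) ≤
      (if I P ℓ then count nP (λ Q → I Q ℓ ∧ erase S P Q) else 0) +
      𝟙 (I P ℓ ∧ (meetSupp Π p c ℓ ≡ᵇ 2))
    line-contribution ℓ with I P ℓ in Pℓ
    ... | false = z≤n
    ... | true rewrite meetSupp-through ℓ Pℓ = 2≤m+𝟙[m≡1] _ (supp-meets-again ℓ Pℓ)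

    supp-point-bound : 2 * suc q < weight Π p c + xP Π p c P
    supp-point-bound = begin-strict
      2 * suc q
        ≡⟨ cong (suc q +_) (+-identityʳ (suc q)) ⟩
      suc q + suc q
        ≡⟨ cong₂ _+_ (pencil-size P) (pencil-size P) ⟨
      count nL (I P) + count nL (I P)
        ≡⟨ sumFin-distrib-+ nL _ _ ⟨
      sumFin nL (λ ℓ → 𝟙 (I P ℓ) + 𝟙 (I P ℓ))
        ≤⟨ sumFin-mono-≤ nL line-contribution ⟩
      sumFin nL (λ ℓ → (if I P ℓ then count nP (λ Q → I Q ℓ ∧ erase S P Q) else 0) +
                       𝟙 (I P ℓ ∧ (meetSupp Π p c ℓ ≡ᵇ 2)))
        ≡⟨ sumFin-distrib-+ nL _ _ ⟩
      sumFin nL (λ ℓ → if I P ℓ then count nP (λ Q → I Q ℓ ∧ erase S P Q) else 0) + xP Π p c P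
        ≡⟨ cong (_+ xP Π p c P) (pencil-partition P (erase S P) (erase-self S P)) ⟩
      count nP (erase S P) + xP Π p c P
        <⟨ n<1+n _ ⟩
      suc (count nP (erase S P)) + xP Π p c P
        ≡⟨ cong (_+ xP Π p c P) (count-remove nP S P P∈S) ⟨
      weight Π p c + xP Π p c P ∎
      where open ≤-Reasoning

mainTheorem13 : (p : ℕ) → Prime p → 3 ≤ p →
    (Π : ProjectivePlane (p * p)) →
    (c : Word Π p) → inDualCode Π p c →
    (ε : ℕ) → 1 ≤ ε → ε ≤ p ∸ 2 →
    weight Π p c ≡ 2 * (p * p) ∸ 2 * p + 2 + ε →
    (P : Fin (ProjectivePlane.nP Π)) → inSupp Π p c P ≡ true →
    2 * p + 1 ∸ ε ≤ xP Π p c P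
mainTheorem13 p _ 3≤p Π c c∈C⊥ ε _ _ weight≡ P P∈S =
  m≤n+o⇒m∸n≤o (2 * p + 1) ε (+-cancelˡ-≤ (B + 2) _ _ (begin
    B + 2 + (2 * p + 1)        ≡⟨ regroup B (2 * p) ⟩
    suc (2 + (B + 2 * p))      ≡⟨ cong (λ n → suc (2 + n)) (m∸n+n≡m 2p≤2p²) ⟩
    suc (2 + 2 * (p * p))      ≡⟨ cong suc (*-suc 2 (p * p)) ⟨
    suc (2 * suc (p * p))      ≤⟨ supp-point-bound Π p c∈C⊥ P∈S ⟩
    weight Π p c + x           ≡⟨ cong (_+ x) weight≡ ⟩
    B + 2 + ε + x              ≡⟨ +-assoc (B + 2) ε x ⟩
    B + 2 + (ε + x)            ∎))
  where
  open ≤-Reasoning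
  B x : ℕ
  B = 2 * (p * p) ∸ 2 * p
  x = xP Π p c P
  2p≤2p² : 2 * p ≤ 2 * (p * p)
  2p≤2p² = *-monoʳ-≤ 2 (m≤m*n p p {{>-nonZero (≤-trans (s≤s z≤n) 3≤p)}})
  regroup : ∀ b d → b + 2 + (d + 1) ≡ suc (2 + (b + d))
  regroup = solve-∀
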